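{- Consider the graph on the set of finite words in the alphabet $\{1,2\}$ (ranked by the sum of the letters) with the following edges. Up edges: one edge from $w$ to $w'$ whenever $w'$ is obtained from $w$ by appending a letter $1$ at the end or by changing one letter $1$ of $w$ into a $2$. Down edges: the number of edges from $w'$ down to $w$ is the number of nonempty sets of positions of letters $1$ in $w'$ whose deletion from $w'$ yields $w$. Then the associated up and down operators satisfy $DU-UD=D+I$, so this graph is a dual filtered graph.
   Context: For a graph with up-edge multiplicities $a_1(x,y)$ (edges from $x$ up to $y$) and down-edge multiplicities $a_2(x,y)$ (edges from $y$ down to $x$), the operators on formal linear combinations of vertices are $Ux=\sum_ya_1(x,y)y$ and $Dy=\sum_xa_2(x,y)x$. -}

module Defs where

open import Data.Nat using (ℕ; zero; suc; _≤?_)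
open import Data.List using (List; []; _∷_; _++_; map; concatMap; filter)
open import Data.Product using (_×_; _,_; proj₁; proj₂)

data Letter : Set where
  one two : Letter

Word : Set
Word = List Letter

-- Formal linear combinations of words with coefficients in ℕ,
-- represented as finite multisets (lists up to permutation, _↭_):
-- the coefficient of v is the number of occurrences of v.
Comb : Set
Comb = List Word

changeOne : Word → List Word
changeOne []        = []
changeOne (one ∷ w) = (two ∷ w) ∷ map (one ∷_) (changeOne w)
changeOne (two ∷ w) = map (two ∷_) (changeOne w)

upEdges : Word → List Word
upEdges w = (w ++ (one ∷ [])) ∷ changeOne w

-- For each set S of positions of letters 1 in w (one entry per set),
-- the word obtained by deleting the letters at S, together with |S|.
deletions : Word → List (Word × ℕ)
deletions []        = ([] , 0) ∷ []
deletions (one ∷ w) =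
  map (λ p → (one ∷ proj₁ p) , proj₂ p) (deletions w)
  ++ map (λ p → proj₁ p , suc (proj₂ p)) (deletions w)
deletions (two ∷ w) = map (λ p → (two ∷ proj₁ p) , proj₂ p) (deletions w)

downEdges : Word → List Word
downEdges w' = map proj₁ (filter (λ p → 1 ≤? proj₂ p) (deletions w'))

U : Comb → Comb
U = concatMap upEdges

D : Comb → Comb
D = concatMap downEdges

-- Write E = D + I for the operator deleting an arbitrary (possibly empty)
-- set of letters 1.  The identity DU - UD = D + I is then equivalent to
-- EU = UE + E, and E is much better behaved than D: deleting from 1w
-- either keeps or deletes the leading 1, so E(1w) = 1·E(w) + E(w); likewise
-- E(2w) = 2·E(w), E(w1) = E(w)·1 + E(w), and E commutes with the operator
-- changing one letter 1 into a 2.  Since U w = w1 + (change one 1 of w),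
-- these give E(U w) = U(E w) + E(w) word by word.
module Submission where

open import Defs
open import Data.Nat using (ℕ; suc; _≤_; _≤?_; s≤s; z≤n)
open import Data.List using (List; []; _∷_; [_]; _++_; _∷ʳ_; map; concatMap; filter)
open import Data.List.Properties
  using (map-++; map-∘; map-cong; map-id; filter-++; filter-all;
         concatMap-cong; concatMap-pure; concatMap-map; map-concatMap; concatMap-++)
open import Data.List.Relation.Unary.All using (universal)
open import Data.Product using (_×_; _,_; proj₁; proj₂)
open import Function using (_∘_; id)
open import Data.Bool using (true; false)
open import Relation.Nullary using (does)
open import Relation.Unary using (Pred; Decidable)
open import Relation.Binary.PropositionalEquality
  using (_≡_; refl; sym; trans; cong; cong₂; module ≡-Reasoning)
open import Data.List.Relation.Binary.Permutation.Propositional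
  using (_↭_; ↭-refl; ↭-trans; ↭-reflexive; module PermutationReasoning)
import Data.List.Relation.Binary.Permutation.Propositional as Perm
open import Data.List.Relation.Binary.Permutation.Propositional.Properties
  using (++⁺; ++⁺ˡ; ++⁺ʳ; map⁺; shifts; drop-∷)
import Data.List.Relation.Binary.Permutation.Propositional.Properties as ↭

module _ {A B X Y : Set} where

  map-square : {f : B → X} {g : A → B} {h : Y → X} {k : A → Y} →
               (∀ x → f (g x) ≡ h (k x)) → ∀ xs → map f (map g xs) ≡ map h (map k xs)
  map-square eq xs = trans (sym (map-∘ xs)) (trans (map-cong eq xs) (map-∘ xs))

module _ {A B : Set} {p} {P : Pred B p} where

  filter-map : (P? : Decidable P) (f : A → B) →
               ∀ xs → filter P? (map f xs) ≡ map f (filter (P? ∘ f) xs)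
  filter-map P? f [] = refl
  filter-map P? f (x ∷ xs) with does (P? (f x))
  ... | true  = cong (f x ∷_) (filter-map P? f xs)
  ... | false = filter-map P? f xs

module _ {A : Set} where

  ++-interchange : (ws xs ys zs : List A) → (ws ++ xs) ++ (ys ++ zs) ↭ (ws ++ ys) ++ (xs ++ zs)
  ++-interchange ws xs ys zs = begin
    (ws ++ xs) ++ (ys ++ zs)   ↭⟨ ↭.++-assoc ws xs (ys ++ zs) ⟩
    ws ++ (xs ++ (ys ++ zs))   ↭⟨ ++⁺ˡ ws (shifts xs ys) ⟩
    ws ++ (ys ++ (xs ++ zs))   ↭⟨ ↭.++-assoc ws ys (xs ++ zs) ⟨
    (ws ++ ys) ++ (xs ++ zs)   ∎
    where open PermutationReasoning

  ++-cancelˡ : ∀ xs {ys zs : List A} → xs ++ ys ↭ xs ++ zs → ys ↭ zs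
  ++-cancelˡ []       p = p
  ++-cancelˡ (x ∷ xs) p = ++-cancelˡ xs (drop-∷ p)

module _ {A B : Set} where

  concatMap⁺ : (f : A → List B) {xs ys : List A} → xs ↭ ys → concatMap f xs ↭ concatMap f ys
  concatMap⁺ f Perm.refl        = ↭-refl
  concatMap⁺ f (Perm.prep x p)  = ++⁺ˡ (f x) (concatMap⁺ f p)
  concatMap⁺ f (Perm.swap x y p) =
    ↭-trans (shifts (f x) (f y)) (++⁺ˡ (f y) (++⁺ˡ (f x) (concatMap⁺ f p)))
  concatMap⁺ f (Perm.trans p q) = ↭-trans (concatMap⁺ f p) (concatMap⁺ f q)

  concatMap-↭ : {f g : A → List B} → (∀ x → f x ↭ g x) → ∀ xs → concatMap f xs ↭ concatMap g xs
  concatMap-↭ f↭g []       = ↭-refl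
  concatMap-↭ f↭g (x ∷ xs) = ++⁺ (f↭g x) (concatMap-↭ f↭g xs)

  concatMap-++-distrib : (f g : A → List B) →
    ∀ xs → concatMap (λ x → f x ++ g x) xs ↭ concatMap f xs ++ concatMap g xs
  concatMap-++-distrib f g []       = ↭-refl
  concatMap-++-distrib f g (x ∷ xs) = begin
    (f x ++ g x) ++ concatMap (λ x → f x ++ g x) xs      ↭⟨ ++⁺ˡ (f x ++ g x) (concatMap-++-distrib f g xs) ⟩
    (f x ++ g x) ++ (concatMap f xs ++ concatMap g xs)   ↭⟨ ++-interchange (f x) (g x) _ _ ⟩
    (f x ++ concatMap f xs) ++ (g x ++ concatMap g xs)   ∎
    where open PermutationReasoning

  concatMap-∷-distrib : (f : A → B) (g : A → List B) →
    ∀ xs → concatMap (λ x → f x ∷ g x) xs ↭ map f xs ++ concatMap g xs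
  concatMap-∷-distrib f g xs = ↭-trans (concatMap-++-distrib ([_] ∘ f) g xs)
    (↭-reflexive (cong (_++ concatMap g xs)
      (trans (sym (concatMap-map [_] f xs)) (concatMap-pure (map f xs)))))

module _ {A B X : Set} where

  concatMap-concatMap : (g : B → List X) (f : A → List B) →
    ∀ xs → concatMap g (concatMap f xs) ≡ concatMap (concatMap g ∘ f) xs
  concatMap-concatMap g f []       = refl
  concatMap-concatMap g f (x ∷ xs) =
    trans (concatMap-++ g (f x) (concatMap f xs)) (cong (concatMap g (f x) ++_) (concatMap-concatMap g f xs))

deleteOnes : Word → Comb
deleteOnes w = map proj₁ (deletions w)

E : Comb → Comb
E = concatMap deleteOnes

C : Comb → Comb
C = concatMap changeOne

keepOne deleteOne : Word × ℕ → Word × ℕ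
keepOne   (v , k) = (one ∷ v) , k
deleteOne (v , k) = v , suc k

deleteOnes-one : ∀ w → deleteOnes (one ∷ w) ≡ map (one ∷_) (deleteOnes w) ++ deleteOnes w
deleteOnes-one w = begin
  map proj₁ (map keepOne ds ++ map deleteOne ds)                 ≡⟨ map-++ proj₁ (map keepOne ds) (map deleteOne ds) ⟩
  map proj₁ (map keepOne ds) ++ map proj₁ (map deleteOne ds)     ≡⟨ cong₂ _++_ (map-square (λ _ → refl) ds) (sym (map-∘ ds)) ⟩
  map (one ∷_) (map proj₁ ds) ++ map proj₁ ds                    ∎
  where
  open ≡-Reasoning
  ds = deletions w

deleteOnes-two : ∀ w → deleteOnes (two ∷ w) ≡ map (two ∷_) (deleteOnes w)
deleteOnes-two w = map-square (λ _ → refl) (deletions w)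

E-map-one : ∀ c → E (map (one ∷_) c) ↭ map (one ∷_) (E c) ++ E c
E-map-one c = begin
  E (map (one ∷_) c)                                            ≡⟨ concatMap-map deleteOnes (one ∷_) c ⟩
  concatMap (deleteOnes ∘ (one ∷_)) c                           ≡⟨ concatMap-cong deleteOnes-one c ⟩
  concatMap (λ w → map (one ∷_) (deleteOnes w) ++ deleteOnes w) c ↭⟨ concatMap-++-distrib (map (one ∷_) ∘ deleteOnes) deleteOnes c ⟩
  concatMap (map (one ∷_) ∘ deleteOnes) c ++ E c                ≡⟨ cong (_++ E c) (map-concatMap (one ∷_) deleteOnes c) ⟨
  map (one ∷_) (E c) ++ E c                                     ∎
  where open PermutationReasoning

E-map-two : ∀ c → E (map (two ∷_) c) ≡ map (two ∷_) (E c)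
E-map-two c = begin
  E (map (two ∷_) c)                    ≡⟨ concatMap-map deleteOnes (two ∷_) c ⟩
  concatMap (deleteOnes ∘ (two ∷_)) c   ≡⟨ concatMap-cong deleteOnes-two c ⟩
  concatMap (map (two ∷_) ∘ deleteOnes) c ≡⟨ map-concatMap (two ∷_) deleteOnes c ⟨
  map (two ∷_) (E c)                    ∎
  where open ≡-Reasoning

C-map-one : ∀ c → C (map (one ∷_) c) ↭ map (two ∷_) c ++ map (one ∷_) (C c)
C-map-one c = begin
  C (map (one ∷_) c)                                    ≡⟨ concatMap-map changeOne (one ∷_) c ⟩
  concatMap (λ w → (two ∷ w) ∷ map (one ∷_) (changeOne w)) c ↭⟨ concatMap-∷-distrib (two ∷_) (map (one ∷_) ∘ changeOne) c ⟩
  map (two ∷_) c ++ concatMap (map (one ∷_) ∘ changeOne) c ≡⟨ cong (map (two ∷_) c ++_) (map-concatMap (one ∷_) changeOne c) ⟨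
  map (two ∷_) c ++ map (one ∷_) (C c)                  ∎
  where open PermutationReasoning

C-map-two : ∀ c → C (map (two ∷_) c) ≡ map (two ∷_) (C c)
C-map-two c = trans (concatMap-map changeOne (two ∷_) c) (sym (map-concatMap (two ∷_) changeOne c))

E-changeOne : ∀ w → E (changeOne w) ↭ C (deleteOnes w)
E-changeOne []        = ↭-refl
E-changeOne (one ∷ v) = begin
  deleteOnes (two ∷ v) ++ E (map (one ∷_) (changeOne v))          ≡⟨ cong (_++ E (map (one ∷_) (changeOne v))) (deleteOnes-two v) ⟩
  map (two ∷_) ev ++ E (map (one ∷_) (changeOne v))               ↭⟨ ++⁺ˡ (map (two ∷_) ev) (E-map-one (changeOne v)) ⟩
  map (two ∷_) ev ++ (map (one ∷_) (E (changeOne v)) ++ E (changeOne v))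
    ↭⟨ ++⁺ˡ (map (two ∷_) ev) (++⁺ (map⁺ (one ∷_) (E-changeOne v)) (E-changeOne v)) ⟩
  map (two ∷_) ev ++ (map (one ∷_) (C ev) ++ C ev)                ↭⟨ ↭.++-assoc (map (two ∷_) ev) _ _ ⟨
  (map (two ∷_) ev ++ map (one ∷_) (C ev)) ++ C ev                ↭⟨ ++⁺ʳ (C ev) (C-map-one ev) ⟨
  C (map (one ∷_) ev) ++ C ev                                     ≡⟨ concatMap-++ changeOne (map (one ∷_) ev) ev ⟨
  C (map (one ∷_) ev ++ ev)                                       ≡⟨ cong C (deleteOnes-one v) ⟨
  C (deleteOnes (one ∷ v))                                        ∎
  where
  open PermutationReasoning
  ev = deleteOnes v
E-changeOne (two ∷ v) = begin
  E (map (two ∷_) (changeOne v))    ≡⟨ E-map-two (changeOne v) ⟩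
  map (two ∷_) (E (changeOne v))    ↭⟨ map⁺ (two ∷_) (E-changeOne v) ⟩
  map (two ∷_) (C (deleteOnes v))   ≡⟨ C-map-two (deleteOnes v) ⟨
  C (map (two ∷_) (deleteOnes v))   ≡⟨ cong C (deleteOnes-two v) ⟨
  C (deleteOnes (two ∷ v))          ∎
  where open PermutationReasoning

deleteOnes-∷ʳ-one : ∀ w → deleteOnes (w ∷ʳ one) ↭ map (_∷ʳ one) (deleteOnes w) ++ deleteOnes w
deleteOnes-∷ʳ-one []        = ↭-refl
deleteOnes-∷ʳ-one (one ∷ v) = begin
  deleteOnes (one ∷ v ∷ʳ one)                                     ≡⟨ deleteOnes-one (v ∷ʳ one) ⟩
  map (one ∷_) (deleteOnes (v ∷ʳ one)) ++ deleteOnes (v ∷ʳ one)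
    ↭⟨ ++⁺ (map⁺ (one ∷_) (deleteOnes-∷ʳ-one v)) (deleteOnes-∷ʳ-one v) ⟩
  map (one ∷_) (map snoc ev ++ ev) ++ (map snoc ev ++ ev)         ≡⟨ cong (_++ (map snoc ev ++ ev)) (map-++ (one ∷_) (map snoc ev) ev) ⟩
  (map (one ∷_) (map snoc ev) ++ map (one ∷_) ev) ++ (map snoc ev ++ ev)
    ↭⟨ ++-interchange (map (one ∷_) (map snoc ev)) _ _ _ ⟩
  (map (one ∷_) (map snoc ev) ++ map snoc ev) ++ (map (one ∷_) ev ++ ev)
    ≡⟨ cong (λ xs → (xs ++ map snoc ev) ++ (map (one ∷_) ev ++ ev)) (map-square (λ _ → refl) ev) ⟩
  (map snoc (map (one ∷_) ev) ++ map snoc ev) ++ (map (one ∷_) ev ++ ev)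
    ≡⟨ cong (_++ (map (one ∷_) ev ++ ev)) (map-++ snoc (map (one ∷_) ev) ev) ⟨
  map snoc (map (one ∷_) ev ++ ev) ++ (map (one ∷_) ev ++ ev)     ≡⟨ cong (λ xs → map snoc xs ++ xs) (deleteOnes-one v) ⟨
  map snoc (deleteOnes (one ∷ v)) ++ deleteOnes (one ∷ v)         ∎
  where
  open PermutationReasoning
  snoc = _∷ʳ one
  ev = deleteOnes v
deleteOnes-∷ʳ-one (two ∷ v) = begin
  deleteOnes (two ∷ v ∷ʳ one)                          ≡⟨ deleteOnes-two (v ∷ʳ one) ⟩
  map (two ∷_) (deleteOnes (v ∷ʳ one))                 ↭⟨ map⁺ (two ∷_) (deleteOnes-∷ʳ-one v) ⟩
  map (two ∷_) (map snoc ev ++ ev)                     ≡⟨ map-++ (two ∷_) (map snoc ev) ev ⟩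
  map (two ∷_) (map snoc ev) ++ map (two ∷_) ev        ≡⟨ cong (_++ map (two ∷_) ev) (map-square (λ _ → refl) ev) ⟩
  map snoc (map (two ∷_) ev) ++ map (two ∷_) ev        ≡⟨ cong (λ xs → map snoc xs ++ xs) (deleteOnes-two v) ⟨
  map snoc (deleteOnes (two ∷ v)) ++ deleteOnes (two ∷ v) ∎
  where
  open PermutationReasoning
  snoc = _∷ʳ one
  ev = deleteOnes v

U-split : ∀ c → U c ↭ map (_∷ʳ one) c ++ C c
U-split = concatMap-∷-distrib (_∷ʳ one) changeOne

E-upEdges : ∀ w → E (upEdges w) ↭ U (deleteOnes w) ++ deleteOnes w
E-upEdges w = begin
  deleteOnes (w ∷ʳ one) ++ E (changeOne w)   ↭⟨ ++⁺ (deleteOnes-∷ʳ-one w) (E-changeOne w) ⟩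
  (map (_∷ʳ one) ew ++ ew) ++ C ew           ↭⟨ ↭.++-assoc (map (_∷ʳ one) ew) ew (C ew) ⟩
  map (_∷ʳ one) ew ++ (ew ++ C ew)           ↭⟨ ++⁺ˡ (map (_∷ʳ one) ew) (↭.++-comm ew (C ew)) ⟩
  map (_∷ʳ one) ew ++ (C ew ++ ew)           ↭⟨ ↭.++-assoc (map (_∷ʳ one) ew) (C ew) ew ⟨
  (map (_∷ʳ one) ew ++ C ew) ++ ew           ↭⟨ ++⁺ʳ ew (U-split ew) ⟨
  U ew ++ ew                                 ∎
  where
  open PermutationReasoning
  ew = deleteOnes w

E-U : ∀ c → E (U c) ↭ U (E c) ++ E c
E-U c = begin
  E (U c)                                            ≡⟨ concatMap-concatMap deleteOnes upEdges c ⟩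
  concatMap (E ∘ upEdges) c                          ↭⟨ concatMap-↭ E-upEdges c ⟩
  concatMap (λ w → U (deleteOnes w) ++ deleteOnes w) c ↭⟨ concatMap-++-distrib (U ∘ deleteOnes) deleteOnes c ⟩
  concatMap (U ∘ deleteOnes) c ++ E c                ≡⟨ cong (_++ E c) (concatMap-concatMap upEdges deleteOnes c) ⟨
  U (E c) ++ E c                                     ∎
  where open PermutationReasoning

nonempty? : Decidable {A = Word × ℕ} (λ p → 1 ≤ proj₂ p)
nonempty? p = 1 ≤? proj₂ p

downEdges-one : ∀ w → downEdges (one ∷ w) ≡ map (one ∷_) (downEdges w) ++ deleteOnes w
downEdges-one w = begin
  map proj₁ (filter nonempty? (map keepOne ds ++ map deleteOne ds))
    ≡⟨ cong (map proj₁) (filter-++ nonempty? (map keepOne ds) (map deleteOne ds)) ⟩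
  map proj₁ (filter nonempty? (map keepOne ds) ++ filter nonempty? (map deleteOne ds))
    ≡⟨ cong (map proj₁) (cong₂ _++_ (filter-map nonempty? keepOne ds) deleteOne-nonempty) ⟩
  map proj₁ (map keepOne (filter nonempty? ds) ++ map deleteOne ds)
    ≡⟨ map-++ proj₁ (map keepOne (filter nonempty? ds)) (map deleteOne ds) ⟩
  map proj₁ (map keepOne (filter nonempty? ds)) ++ map proj₁ (map deleteOne ds)
    ≡⟨ cong₂ _++_ (map-square (λ _ → refl) (filter nonempty? ds)) (sym (map-∘ ds)) ⟩
  map (one ∷_) (downEdges w) ++ deleteOnes w ∎
  where
  open ≡-Reasoning
  ds = deletions w
  deleteOne-nonempty : filter nonempty? (map deleteOne ds) ≡ map deleteOne ds
  deleteOne-nonempty = trans (filter-map nonempty? deleteOne ds)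
    (cong (map deleteOne) (filter-all (nonempty? ∘ deleteOne) (universal (λ _ → s≤s z≤n) ds)))

downEdges-two : ∀ w → downEdges (two ∷ w) ≡ map (two ∷_) (downEdges w)
downEdges-two w = begin
  map proj₁ (filter nonempty? (map (λ p → (two ∷ proj₁ p) , proj₂ p) ds))
    ≡⟨ cong (map proj₁) (filter-map nonempty? _ ds) ⟩
  map proj₁ (map (λ p → (two ∷ proj₁ p) , proj₂ p) (filter nonempty? ds))
    ≡⟨ map-square (λ _ → refl) (filter nonempty? ds) ⟩
  map (two ∷_) (downEdges w) ∎
  where
  open ≡-Reasoning
  ds = deletions w

deleteOnes-↭ : ∀ w → deleteOnes w ↭ w ∷ downEdges w
deleteOnes-↭ []        = ↭-refl
deleteOnes-↭ (one ∷ v) = begin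
  deleteOnes (one ∷ v)                                     ≡⟨ deleteOnes-one v ⟩
  map (one ∷_) (deleteOnes v) ++ deleteOnes v              ↭⟨ ++⁺ʳ (deleteOnes v) (map⁺ (one ∷_) (deleteOnes-↭ v)) ⟩
  (one ∷ v) ∷ map (one ∷_) (downEdges v) ++ deleteOnes v   ≡⟨ cong ((one ∷ v) ∷_) (downEdges-one v) ⟨
  (one ∷ v) ∷ downEdges (one ∷ v)                          ∎
  where open PermutationReasoning
deleteOnes-↭ (two ∷ v) = begin
  deleteOnes (two ∷ v)                 ≡⟨ deleteOnes-two v ⟩
  map (two ∷_) (deleteOnes v)          ↭⟨ map⁺ (two ∷_) (deleteOnes-↭ v) ⟩
  (two ∷ v) ∷ map (two ∷_) (downEdges v) ≡⟨ cong ((two ∷ v) ∷_) (downEdges-two v) ⟨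
  (two ∷ v) ∷ downEdges (two ∷ v)      ∎
  where open PermutationReasoning

E-↭ : ∀ c → E c ↭ c ++ D c
E-↭ c = begin
  E c                                 ↭⟨ concatMap-↭ deleteOnes-↭ c ⟩
  concatMap (λ w → w ∷ downEdges w) c ↭⟨ concatMap-∷-distrib id downEdges c ⟩
  map id c ++ D c                     ≡⟨ cong (_++ D c) (map-id c) ⟩
  c ++ D c                            ∎
  where open PermutationReasoning

mainTheorem12 : (c : Comb) → D (U c) ↭ U (D c) ++ D c ++ c
mainTheorem12 c = ++-cancelˡ (U c) (begin
  U c ++ D (U c)                 ↭⟨ E-↭ (U c) ⟨
  E (U c)                        ↭⟨ E-U c ⟩
  U (E c) ++ E c                 ↭⟨ ++⁺ (concatMap⁺ upEdges (E-↭ c)) (E-↭ c) ⟩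
  U (c ++ D c) ++ (c ++ D c)     ≡⟨ cong (_++ (c ++ D c)) (concatMap-++ upEdges c (D c)) ⟩
  (U c ++ U (D c)) ++ (c ++ D c) ↭⟨ ↭.++-assoc (U c) (U (D c)) (c ++ D c) ⟩
  U c ++ U (D c) ++ c ++ D c     ↭⟨ ++⁺ˡ (U c) (++⁺ˡ (U (D c)) (↭.++-comm c (D c))) ⟩
  U c ++ U (D c) ++ D c ++ c     ∎)
  where open PermutationReasoning
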